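{- Let $\phi$ be a Hecke–Maass cusp form for $SL(4,\mathbb Z)$ with Fourier coefficients $A(m_1,m_2,m_3)$ normalized by $A(1,1,1)=1$. For all positive integers $k,\ell,n$, $$A(k,\ell,n)=\sum_{\substack{d,e,f\\ d\mid (k,\ell),\ e\mid (d,k/d),\\ f\mid (k,n)}}\mu(df)\mu(e)\,A\Big(\frac{k}{dfe},1,1\Big)A\Big(1,\frac{\ell}{d},\frac{dn}{ef}\Big),$$ with the convention that $A(a,b,c)=0$ whenever one of $a,b,c$ is not an integer.
   Context: $\mu$ is the Möbius function. The coefficients satisfy the Hecke relations, in particular $A(k,1,1)A(1,\ell,d)=\sum_{c_1c_2\mid k,\ c_1\mid \ell,\ c_2\mid d}A\big(\frac{k}{c_1c_2},\frac{\ell}{c_1},\frac{dc_1}{c_2}\big)$. -}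

module Defs where

open import Level using (Level)
open import Algebra.Bundles using (CommutativeRing)
open import Data.Nat using (ℕ; zero; suc; _*_; _/_)
open import Data.Nat.Divisibility using (_∣_; _∣?_)
open import Data.Nat.Primality using (prime?)
open import Data.List using (List; []; _∷_; map; filter; upTo; length)
open import Data.Bool.ListAction using (any)
open import Data.Bool using (Bool; true; false; if_then_else_)
open import Data.Integer using (ℤ; +_; -[1+_])
open import Data.Product using (_×_; _,_)
open import Relation.Nullary.Decidable using (Dec; yes; no; ⌊_⌋)

divisors : ℕ → List ℕ
divisors n = filter (λ d → d ∣? n) (map suc (upTo n))

squarefree : ℕ → Bool
squarefree n = if any (λ d → ⌊ (suc (suc d)) * (suc (suc d)) ∣? n ⌋) (upTo n)
                 then false else true

ω : ℕ → ℕ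
ω n = length (filter prime? (divisors n))

-- Möbius function (μ 0 = 0 by convention; only used at positive arguments)
μ : ℕ → ℤ
μ zero = + 0
μ (suc n) with squarefree (suc n)
... | false = + 0
... | true = sign (ω (suc n))
  where
  sign : ℕ → ℤ
  sign zero = + 1
  sign (suc zero) = -[1+ 0 ]
  sign (suc (suc m)) = sign m

-- truncated quotient with q a 0 = 0 (denominators are always positive in use)
quot : ℕ → ℕ → ℕ
quot a zero = 0
quot a (suc b) = a / suc b

module Coeffs {c ℓ : Level} (R : CommutativeRing c ℓ) where
  open CommutativeRing R

  fromℕ : ℕ → Carrier
  fromℕ zero = 0#
  fromℕ (suc n) = 1# + fromℕ n

  fromℤ : ℤ → Carrier
  fromℤ (+ n) = fromℕ n
  fromℤ -[1+ n ] = - fromℕ (suc n)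

  Σ : List ℕ → (ℕ → Carrier) → Carrier
  Σ [] g = 0#
  Σ (x ∷ xs) g = g x + Σ xs g

  when : {P : Set} → Dec P → Carrier → Carrier
  when (yes _) x = x
  when (no _) x = 0#

  -- A(a/a', b/b', c/c') with the convention that it is 0 when one
  -- of the three quotients is not an integer
  Aq : (ℕ → ℕ → ℕ → Carrier) → ℕ × ℕ → ℕ × ℕ → ℕ × ℕ → Carrier
  Aq A (a , a') (b , b') (c , c') =
    when (a' ∣? a) (when (b' ∣? b) (when (c' ∣? c)
      (A (quot a a') (quot b b') (quot c c'))))

-- The right-hand side is unwound by two Möbius inversions. Fix d ∣ (k, l) and put K = k/d,
-- L = l/d, D = dn. Substituting m = ef, the (e, f)-sum becomes
-- μ(d) Σ_{m ∣ (K, D)} μ(m) A(K/m, 1, 1) A(1, L, D/m): a squarefree m ∣ K leaves only e = (d, m),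
-- and then f ∣ n with (d, f) = 1 amounts to m ∣ D. Writing the Hecke relation for
-- A(K/m, 1, 1) A(1, L, D/m) with the sum over c₂ outermost and inverting it in c₂ turns this into
-- μ(d) Σ_{c ∣ (K, L)} A(K/c, L/c, Dc), and Σ_{d ∣ (k, l)} μ(d) Σ_{c ∣ (k/d, l/d)} A(k/dc, l/dc, ndc)
-- is A(k, l, n) by Möbius inversion once more. Sums over divisors are encoded as sums over
-- [0, N) guarded by divisibility, for one bound N exceeding every number that occurs.

module Submission where

open import Defs
open import Level using (Level)
open import Algebra.Bundles using (CommutativeRing; CommutativeSemiring)
open import Data.Nat using (ℕ; NonZero; zero; suc; _≤_; _<_; z≤n; s≤s) renaming (_*_ to _⋅_)
open import Data.Nat.Divisibility using (_∣_; _∣?_)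
open import Data.Nat.GCD using (gcd)
open import Data.Product using (_,_)
open import Relation.Binary.PropositionalEquality using (_≡_; _≢_)

module Division where

  open import Data.Nat using (_/_; >-nonZero)
  open import Data.Nat.Properties using (*-comm; *-assoc; *-zeroʳ; <⇒≢; n≢0⇒n>0)
  open import Data.Nat.Divisibility using (∣⇒≤; 0∣⇒≡0; *-monoʳ-∣; m*n∣o⇒n∣o/m)
  open import Data.Nat.DivMod using (m*[n/m]≡n; m*n/n≡m; m/n≤m; m/n/o≡m/[n*o]; n/1≡n)
  open import Data.Nat.GCD using (gcd[m,n]∣m; gcd[m,n]≡0⇒m≡0; gcd[cm,cn]/c≡gcd[m,n])
  open import Data.Empty using (⊥-elim)
  open import Relation.Binary.PropositionalEquality

  quot≡/ : ∀ a b .{{_ : NonZero b}} → quot a b ≡ a / b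
  quot≡/ a (suc b) = refl

  *-pos : ∀ {a b} → 0 < a → 0 < b → 0 < a ⋅ b
  *-pos {suc a} {suc b} _ _ = s≤s z≤n

  ∣⇒pos : ∀ {a b} → 0 < b → a ∣ b → 0 < a
  ∣⇒pos {zero} 0<b a∣b = ⊥-elim (<⇒≢ 0<b (sym (0∣⇒≡0 a∣b)))
  ∣⇒pos {suc a} _ _ = s≤s z≤n

  ∣⇒≤′ : ∀ {a b} → 0 < b → a ∣ b → a ≤ b
  ∣⇒≤′ 0<b = ∣⇒≤ {{>-nonZero 0<b}}

  *-quot : ∀ {a b} → 0 < b → b ∣ a → b ⋅ quot a b ≡ a
  *-quot {a} {b} 0<b b∣a = trans (cong (b ⋅_) (quot≡/ a b)) (m*[n/m]≡n b∣a)
    where instance _ = >-nonZero 0<b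

  quot-* : ∀ b c → 0 < b → quot (b ⋅ c) b ≡ c
  quot-* b c 0<b = trans (quot≡/ (b ⋅ c) b) (trans (cong (_/ b) (*-comm b c)) (m*n/n≡m c b))
    where instance _ = >-nonZero 0<b

  *∣⇒∣quot : ∀ {a b c} → 0 < b → b ⋅ c ∣ a → c ∣ quot a b
  *∣⇒∣quot {a} {b} {c} 0<b bc∣a = subst (c ∣_) (sym (quot≡/ a b)) (m*n∣o⇒n∣o/m b c bc∣a)
    where instance _ = >-nonZero 0<b

  ∣quot⇒*∣ : ∀ {a b c} → 0 < b → b ∣ a → c ∣ quot a b → b ⋅ c ∣ a
  ∣quot⇒*∣ {a} {b} {c} 0<b b∣a c∣a/b = subst (b ⋅ c ∣_) (*-quot 0<b b∣a) (*-monoʳ-∣ b c∣a/b)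

  quot-pos : ∀ {a b} → 0 < a → 0 < b → b ∣ a → 0 < quot a b
  quot-pos {a} {b} 0<a 0<b b∣a = n≢0⇒n>0 λ q≡0 → <⇒≢ 0<a (sym (begin
    a                ≡⟨ sym (*-quot 0<b b∣a) ⟩
    b ⋅ quot a b     ≡⟨ cong (b ⋅_) q≡0 ⟩
    b ⋅ 0            ≡⟨ *-zeroʳ b ⟩
    0                ∎))
    where open ≡-Reasoning

  quot≤ : ∀ a b → quot a b ≤ a
  quot≤ a zero = z≤n
  quot≤ a (suc b) = m/n≤m a (suc b)

  quot-1 : ∀ a → quot a 1 ≡ a
  quot-1 = n/1≡n

  quot-quot : ∀ a b c → quot (quot a b) c ≡ quot a (b ⋅ c)
  quot-quot a zero zero = refl
  quot-quot a zero (suc c) = refl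
  quot-quot a (suc b) zero = cong (quot a) (sym (*-zeroʳ b))
  quot-quot a (suc b) (suc c) = m/n/o≡m/[n*o] a (suc b) (suc c)

  quot-*ʳ : ∀ a b c → 0 < b → b ∣ a → quot (a ⋅ c) b ≡ quot a b ⋅ c
  quot-*ʳ a b c 0<b b∣a = begin
    quot (a ⋅ c) b                ≡⟨ cong (λ x → quot (x ⋅ c) b) (sym (*-quot 0<b b∣a)) ⟩
    quot (b ⋅ quot a b ⋅ c) b     ≡⟨ cong (λ x → quot x b) (*-assoc b (quot a b) c) ⟩
    quot (b ⋅ (quot a b ⋅ c)) b   ≡⟨ quot-* b _ 0<b ⟩
    quot a b ⋅ c                  ∎
    where open ≡-Reasoning

  gcd-pos : ∀ {a} b → 0 < a → 0 < gcd a b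
  gcd-pos b 0<a = n≢0⇒n>0 λ g≡0 → <⇒≢ 0<a (sym (gcd[m,n]≡0⇒m≡0 g≡0))

  gcd≤ : ∀ {a} b → 0 < a → gcd a b ≤ a
  gcd≤ {a} b 0<a = ∣⇒≤′ 0<a (gcd[m,n]∣m a b)

  gcd-quot : ∀ {a b g} → 0 < g → g ∣ a → g ∣ b → gcd (quot a g) (quot b g) ≡ quot (gcd a b) g
  gcd-quot {a} {b} {g} 0<g g∣a g∣b = sym (begin
    quot (gcd a b) g
      ≡⟨ cong₂ (λ x y → quot (gcd x y) g) (sym (*-quot 0<g g∣a)) (sym (*-quot 0<g g∣b)) ⟩
    quot (gcd (g ⋅ quot a g) (g ⋅ quot b g)) g
      ≡⟨ quot≡/ _ g ⟩
    gcd (g ⋅ quot a g) (g ⋅ quot b g) / g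
      ≡⟨ gcd[cm,cn]/c≡gcd[m,n] g (quot a g) (quot b g) ⟩
    gcd (quot a g) (quot b g)                  ∎)
    where
    open ≡-Reasoning
    instance _ = >-nonZero 0<g

open Division

module RangeSum {ℓ₁ ℓ₂ : Level} (S : CommutativeSemiring ℓ₁ ℓ₂) where

  open CommutativeSemiring S
  open import Algebra.Properties.CommutativeSemigroup +-commutativeSemigroup using (interchange)
  open import Data.Nat using () renaming (_+_ to _+ℕ_)
  open import Data.Nat using (pred)
  import Relation.Binary.PropositionalEquality as ≡

  ∑ : ℕ → (ℕ → Carrier) → Carrier
  ∑ zero f = 0#
  ∑ (suc N) f = f 0 + ∑ N (λ x → f (suc x))

  ∑-cong< : ∀ N {f g : ℕ → Carrier} → (∀ x → x < N → f x ≈ g x) → ∑ N f ≈ ∑ N g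
  ∑-cong< zero f≈g = refl
  ∑-cong< (suc N) f≈g = +-cong (f≈g 0 (s≤s z≤n)) (∑-cong< N λ x x<N → f≈g (suc x) (s≤s x<N))

  ∑-cong : ∀ N {f g : ℕ → Carrier} → (∀ x → f x ≈ g x) → ∑ N f ≈ ∑ N g
  ∑-cong N f≈g = ∑-cong< N λ x _ → f≈g x

  ∑-zero : ∀ N {f : ℕ → Carrier} → (∀ x → x < N → f x ≈ 0#) → ∑ N f ≈ 0#
  ∑-zero zero f≈0 = refl
  ∑-zero (suc N) f≈0 = trans (+-cong (f≈0 0 (s≤s z≤n)) (∑-zero N λ x x<N → f≈0 (suc x) (s≤s x<N)))
                             (+-identityʳ 0#)

  ∑-distrib-+ : ∀ N (f g : ℕ → Carrier) → ∑ N (λ x → f x + g x) ≈ ∑ N f + ∑ N g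
  ∑-distrib-+ zero f g = sym (+-identityʳ 0#)
  ∑-distrib-+ (suc N) f g = trans (+-cong refl (∑-distrib-+ N _ _)) (interchange _ _ _ _)

  *-distribˡ-∑ : ∀ N a (f : ℕ → Carrier) → a * ∑ N f ≈ ∑ N (λ x → a * f x)
  *-distribˡ-∑ zero a f = zeroʳ a
  *-distribˡ-∑ (suc N) a f = trans (distribˡ a _ _) (+-cong refl (*-distribˡ-∑ N a _))

  *-distribʳ-∑ : ∀ N a (f : ℕ → Carrier) → ∑ N f * a ≈ ∑ N (λ x → f x * a)
  *-distribʳ-∑ N a f = trans (*-comm _ a) (trans (*-distribˡ-∑ N a f) (∑-cong N λ x → *-comm a (f x)))

  ∑-+ℕ : ∀ M N (f : ℕ → Carrier) → ∑ (M +ℕ N) f ≈ ∑ M f + ∑ N (λ x → f (M +ℕ x))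
  ∑-+ℕ zero N f = sym (+-identityˡ _)
  ∑-+ℕ (suc M) N f = trans (+-cong refl (∑-+ℕ M N _)) (sym (+-assoc _ _ _))

  ∑-extend : ∀ M N (f : ℕ → Carrier) → M ≤ N → (∀ x → M ≤ x → f x ≈ 0#) → ∑ N f ≈ ∑ M f
  ∑-extend zero N f _ f≈0 = ∑-zero N λ x _ → f≈0 x z≤n
  ∑-extend (suc M) (suc N) f (s≤s M≤N) f≈0 =
    +-cong refl (∑-extend M N _ M≤N λ x M≤x → f≈0 (suc x) (s≤s M≤x))

  ∑-comm : ∀ M N (f : ℕ → ℕ → Carrier) → ∑ M (λ x → ∑ N (f x)) ≈ ∑ N (λ y → ∑ M (λ x → f x y))
  ∑-comm zero N f = sym (∑-zero N λ _ _ → refl)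
  ∑-comm (suc M) N f = trans (+-cong refl (∑-comm M N _)) (sym (∑-distrib-+ N _ _))

  ∑-single : ∀ N a (f : ℕ → Carrier) → a < N → (∀ x → x < N → x ≢ a → f x ≈ 0#) → ∑ N f ≈ f a
  ∑-single (suc N) zero f _ f≈0 =
    trans (+-cong refl (∑-zero N λ x x<N → f≈0 (suc x) (s≤s x<N) λ ())) (+-identityʳ _)
  ∑-single (suc N) (suc a) f (s≤s a<N) f≈0 =
    trans (+-cong (f≈0 0 (s≤s z≤n) λ ())
                  (∑-single N a _ a<N λ x x<N x≢a → f≈0 (suc x) (s≤s x<N) λ eq → x≢a (≡.cong pred eq)))
          (+-identityˡ _)

module MöbiusFunction where

  open import Data.Nat using (_+_; nonTrivial⇒n>1; >-nonZero; z<s; 2+)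
  open import Data.Nat.Properties
  open import Data.Nat.Divisibility
  open import Data.Nat.Primality
  open import Data.Nat.Primality.Factorisation using (factorise)
  open import Data.Nat.Coprimality using (Coprime; gcd≡1⇒coprime)
  open import Data.Nat.GCD using (gcd[m,n]∣m; gcd[m,n]∣n; gcd[m,n]≡0⇒m≡0)
  open import Data.Integer as ℤ using (ℤ; +_; -[1+_])
  import Data.Integer.Properties as ℤ
  open import Data.Bool using (Bool; true; false; T; if_then_else_)
  open import Data.Bool.ListAction using (any)
  open import Data.List using ([]; _∷_; map; filter; upTo; applyUpTo; length)
  open import Data.List.Properties using (map-upTo)
  open import Data.List.Relation.Unary.All using (_∷_)
  open import Data.List.Relation.Unary.Any using (satisfied)
  open import Data.List.Relation.Unary.Any.Properties using (any⁺; any⁻)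
  open import Data.List.Membership.Propositional using (lose)
  open import Data.List.Membership.Propositional.Properties using (∈-upTo⁺)
  open import Data.Product using (∃; _×_)
  open import Data.Sum using (inj₁; inj₂)
  open import Data.Empty using (⊥-elim)
  open import Relation.Nullary using (¬_; Dec; yes; no; does; _×-dec_)
  open import Relation.Nullary.Decidable using (⌊_⌋; fromWitness; toWitness)
  open import Relation.Binary.PropositionalEquality

  open RangeSum +-*-commutativeSemiring

  prime>1 : ∀ {p} → Prime p → 1 < p
  prime>1 {p} pp = nonTrivial⇒n>1 p {{prime⇒nonTrivial pp}}

  prime-pos : ∀ {p} → Prime p → 0 < p
  prime-pos pp = <-trans z<s (prime>1 pp)

  prime∣prime⇒≡ : ∀ {p q} → Prime p → Prime q → p ∣ q → p ≡ q
  prime∣prime⇒≡ pp pq p∣q with prime⇒irreducible pq p∣q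
  ... | inj₁ refl = ⊥-elim (<-irrefl refl (prime>1 pp))
  ... | inj₂ p≡q = p≡q

  prime∤⇒coprime : ∀ {p a} → Prime p → ¬ p ∣ a → Coprime p a
  prime∤⇒coprime pp p∤a (d∣p , d∣a) with prime⇒irreducible pp d∣p
  ... | inj₁ d≡1 = d≡1
  ... | inj₂ refl = ⊥-elim (p∤a d∣a)

  prime-divisor : ∀ {n} → 1 < n → ∃ λ p → Prime p × p ∣ n
  prime-divisor {n} 1<n with factorise n {{>-nonZero (<-trans z<s 1<n)}}
  ... | record { factors = [] ; isFactorisation = n≡1 } = ⊥-elim (<-irrefl (sym n≡1) 1<n)
  ... | record { factors = p ∷ ps ; isFactorisation = n≡p*Πps ; factorsPrime = pp ∷ _ } =
    p , pp , subst (p ∣_) (sym n≡p*Πps) (m∣m*n _)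

  ¬coprime⇒common-prime : ∀ {a b} → 0 < a → ¬ Coprime a b → ∃ λ p → Prime p × p ∣ a × p ∣ b
  ¬coprime⇒common-prime {a} {b} 0<a ¬a⊥b with gcd a b in g≡
  ... | zero = ⊥-elim (<⇒≢ 0<a (sym (gcd[m,n]≡0⇒m≡0 g≡)))
  ... | suc zero = ⊥-elim (¬a⊥b (gcd≡1⇒coprime g≡))
  ... | g@(2+ _) with prime-divisor {g} (s≤s (s≤s z≤n))
  ... | p , pp , p∣g = p , pp , ∣-trans p∣g (subst (_∣ a) g≡ (gcd[m,n]∣m a b))
                             , ∣-trans p∣g (subst (_∣ b) g≡ (gcd[m,n]∣n a b))

  prime²∣*⇒prime²∣ : ∀ {p a b} → Prime p → ¬ p ∣ b → p ⋅ p ∣ a ⋅ b → p ⋅ p ∣ a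
  prime²∣*⇒prime²∣ {p} {a} {b} pp p∤b p²∣ab with euclidsLemma a b pp (∣-trans (m∣m*n p) p²∣ab)
  ... | inj₂ p∣b = ⊥-elim (p∤b p∣b)
  ... | inj₁ (divides a′ refl) with euclidsLemma a′ b pp p∣a′b
    where
    instance _ = prime⇒nonZero pp
    p∣a′b : p ∣ a′ ⋅ b
    p∣a′b = *-cancelˡ-∣ p (subst (p ⋅ p ∣_) (a′⋅p⋅b≡p⋅[a′⋅b]) p²∣ab)
      where
      a′⋅p⋅b≡p⋅[a′⋅b] : a′ ⋅ p ⋅ b ≡ p ⋅ (a′ ⋅ b)
      a′⋅p⋅b≡p⋅[a′⋅b] = trans (cong (_⋅ b) (*-comm a′ p)) (*-assoc p a′ b)
  ... | inj₁ p∣a′ = *-monoˡ-∣ p p∣a′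
  ... | inj₂ p∣b = ⊥-elim (p∤b p∣b)

  SquareFree : ℕ → Set
  SquareFree n = ∀ {p} → Prime p → ¬ (p ⋅ p ∣ n)

  SquareFree-* : ∀ {a b} → Coprime a b → SquareFree a → SquareFree b → SquareFree (a ⋅ b)
  SquareFree-* {a} {b} a⊥b sf-a sf-b {p} pp p²∣ab with p ∣? b
  ... | no p∤b = sf-a pp (prime²∣*⇒prime²∣ pp p∤b p²∣ab)
  ... | yes p∣b = sf-b pp (prime²∣*⇒prime²∣ pp p∤a (subst (p ⋅ p ∣_) (*-comm a b) p²∣ab))
    where
    p∤a : ¬ p ∣ a
    p∤a p∣a = <-irrefl (sym (a⊥b (p∣a , p∣b))) (prime>1 pp)

  private
    square-test : ℕ → ℕ → Bool
    square-test n d = ⌊ suc (suc d) ⋅ suc (suc d) ∣? n ⌋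

    T⇒if≡false : ∀ {b} → T b → (if b then false else true) ≡ false
    T⇒if≡false {true} _ = refl

    if≡false⇒T : ∀ {b} → (if b then false else true) ≡ false → T b
    if≡false⇒T {true} _ = _

  squarefree≡false⇒square : ∀ n → squarefree n ≡ false → ∃ λ p → Prime p × p ⋅ p ∣ n
  squarefree≡false⇒square n sf≡false
    with d , d∈ ← satisfied (any⁻ (square-test n) (upTo n) (if≡false⇒T sf≡false))
    with p , pp , p∣y ← prime-divisor {suc (suc d)} (s≤s (s≤s z≤n))
    = p , pp , ∣-trans (*-pres-∣ p∣y p∣y) (toWitness d∈)

  square⇒squarefree≡false : ∀ {n y} → 0 < n → 1 < y → y ⋅ y ∣ n → squarefree n ≡ false
  square⇒squarefree≡false {n} {2+ d} 0<n (s≤s (s≤s z≤n)) y²∣n =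
    T⇒if≡false (any⁺ (square-test n) (lose (∈-upTo⁺ d<n) (fromWitness y²∣n)))
    where
    d<n : d < n
    d<n = <-≤-trans (m<n+m d (s≤s z≤n)) (≤-trans (m≤m*n (2+ d) (2+ d)) (∣⇒≤ {{>-nonZero 0<n}} y²∣n))

  squarefree≡true⇒SquareFree : ∀ n → 0 < n → squarefree n ≡ true → SquareFree n
  squarefree≡true⇒SquareFree n 0<n sf≡true pp p²∣n
    with () ← trans (sym sf≡true) (square⇒squarefree≡false 0<n (prime>1 pp) p²∣n)

  SquareFree⇒squarefree≡true : ∀ n → SquareFree n → squarefree n ≡ true
  SquareFree⇒squarefree≡true n sf with squarefree n in sf≡
  ... | true = refl
  ... | false with p , pp , p²∣n ← squarefree≡false⇒square n sf≡ = ⊥-elim (sf pp p²∣n)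

  𝟙 : ∀ {P : Set} → Dec P → ℕ
  𝟙 P? = if does P? then 1 else 0

  𝟙-yes : ∀ {P : Set} (P? : Dec P) → P → 𝟙 P? ≡ 1
  𝟙-yes (yes _) _ = refl
  𝟙-yes (no ¬p) p = ⊥-elim (¬p p)

  𝟙-no : ∀ {P : Set} (P? : Dec P) → ¬ P → 𝟙 P? ≡ 0
  𝟙-no (yes p) ¬p = ⊥-elim (¬p p)
  𝟙-no (no _) _ = refl

  filter-filter : ∀ {P Q : ℕ → Set} (P? : ∀ x → Dec (P x)) (Q? : ∀ x → Dec (Q x)) xs →
                  filter P? (filter Q? xs) ≡ filter (λ x → P? x ×-dec Q? x) xs
  filter-filter P? Q? [] = refl
  filter-filter P? Q? (x ∷ xs) with does (Q? x)
  ... | true with does (P? x)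
  ...   | true = cong (x ∷_) (filter-filter P? Q? xs)
  ...   | false = filter-filter P? Q? xs
  filter-filter P? Q? (x ∷ xs) | false with does (P? x)
  ...   | true = filter-filter P? Q? xs
  ...   | false = filter-filter P? Q? xs

  length-filter-applyUpTo : ∀ {P : ℕ → Set} (P? : ∀ x → Dec (P x)) f n →
                            length (filter P? (applyUpTo f n)) ≡ ∑ n (λ x → 𝟙 (P? (f x)))
  length-filter-applyUpTo P? f zero = refl
  length-filter-applyUpTo P? f (suc n) with does (P? (f 0))
  ... | true = cong suc (length-filter-applyUpTo P? (λ x → f (suc x)) n)
  ... | false = length-filter-applyUpTo P? (λ x → f (suc x)) n

  prime-∣? : ∀ y m → Dec (Prime y × y ∣ m)
  prime-∣? y m = prime? y ×-dec y ∣? m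

  ω-∑ : ∀ m {N} → 0 < m → m < N → ω m ≡ ∑ N (λ y → 𝟙 (prime-∣? y m))
  ω-∑ m {N} 0<m m<N = begin
    ω m
      ≡⟨ cong length (filter-filter prime? (_∣? m) (map suc (upTo m))) ⟩
    length (filter (λ y → prime-∣? y m) (map suc (upTo m)))
      ≡⟨ cong (λ xs → length (filter (λ y → prime-∣? y m) xs)) (map-upTo suc m) ⟩
    length (filter (λ y → prime-∣? y m) (applyUpTo suc m))
      ≡⟨ length-filter-applyUpTo (λ y → prime-∣? y m) suc m ⟩
    ∑ (suc m) (λ y → 𝟙 (prime-∣? y m))
      ≡⟨ sym (∑-extend (suc m) N _ m<N no-divisor) ⟩
    ∑ N (λ y → 𝟙 (prime-∣? y m))       ∎
    where
    open ≡-Reasoning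
    no-divisor : ∀ y → suc m ≤ y → 𝟙 (prime-∣? y m) ≡ 0
    no-divisor y m<y = 𝟙-no (prime-∣? y m) λ (_ , y∣m) → <⇒≱ m<y (∣⇒≤ {{>-nonZero 0<m}} y∣m)

  ω-prime : ∀ {p} → Prime p → ω p ≡ 1
  ω-prime {p} pp = begin
    ω p                                ≡⟨ ω-∑ p (prime-pos pp) ≤-refl ⟩
    ∑ (suc p) (λ y → 𝟙 (prime-∣? y p)) ≡⟨ ∑-single (suc p) p _ ≤-refl only-p ⟩
    𝟙 (prime-∣? p p)                   ≡⟨ 𝟙-yes (prime-∣? p p) (pp , ∣-refl) ⟩
    1                                  ∎
    where
    open ≡-Reasoning
    only-p : ∀ y → y < suc p → y ≢ p → 𝟙 (prime-∣? y p) ≡ 0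
    only-p y _ y≢p = 𝟙-no (prime-∣? y p) λ (py , y∣p) → y≢p (prime∣prime⇒≡ py pp y∣p)

  ω-* : ∀ {a b} → 0 < a → 0 < b → Coprime a b → ω (a ⋅ b) ≡ ω a + ω b
  ω-* {a} {b} 0<a 0<b a⊥b = begin
    ω (a ⋅ b)
      ≡⟨ ω-∑ (a ⋅ b) 0<ab ≤-refl ⟩
    ∑ N (λ y → 𝟙 (prime-∣? y (a ⋅ b)))
      ≡⟨ ∑-cong N split ⟩
    ∑ N (λ y → 𝟙 (prime-∣? y a) + 𝟙 (prime-∣? y b))
      ≡⟨ ∑-distrib-+ N (λ y → 𝟙 (prime-∣? y a)) (λ y → 𝟙 (prime-∣? y b)) ⟩
    ∑ N (λ y → 𝟙 (prime-∣? y a)) + ∑ N (λ y → 𝟙 (prime-∣? y b))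
      ≡⟨ sym (cong₂ _+_ (ω-∑ a 0<a (s≤s (m≤m*n a b))) (ω-∑ b 0<b (s≤s (m≤n*m b a)))) ⟩
    ω a + ω b                          ∎
    where
    open ≡-Reasoning
    instance
      _ = >-nonZero 0<a
      _ = >-nonZero 0<b
    0<ab = *-pos 0<a 0<b
    N = suc (a ⋅ b)
    split : ∀ y → 𝟙 (prime-∣? y (a ⋅ b)) ≡ 𝟙 (prime-∣? y a) + 𝟙 (prime-∣? y b)
    split y with prime? y
    ... | no _ = refl
    ... | yes py with y ∣? a ⋅ b | y ∣? a | y ∣? b
    ... | _ | yes y∣a | yes y∣b = ⊥-elim (<-irrefl (sym (a⊥b (y∣a , y∣b))) (prime>1 py))
    ... | yes _ | yes _ | no _ = refl
    ... | yes _ | no _ | yes _ = refl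
    ... | yes y∣ab | no y∤a | no y∤b with euclidsLemma a b py y∣ab
    ...   | inj₁ y∣a = ⊥-elim (y∤a y∣a)
    ...   | inj₂ y∣b = ⊥-elim (y∤b y∣b)
    split y | yes py | no y∤ab | yes y∣a | no _ = ⊥-elim (y∤ab (∣m⇒∣m*n b y∣a))
    split y | yes py | no y∤ab | no _ | yes y∣b = ⊥-elim (y∤ab (∣n⇒∣m*n a y∣b))
    split y | yes py | no _ | no _ | no _ = refl

  sgn : ℕ → ℤ
  sgn zero = + 1
  sgn (suc zero) = -[1+ 0 ]
  sgn (2+ w) = sgn w

  sgn-unique : ∀ {F : ℕ → ℤ} → F 0 ≡ + 1 → F 1 ≡ -[1+ 0 ] → (∀ w → F (2+ w) ≡ F w) →
               ∀ w → F w ≡ sgn w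
  sgn-unique F0 F1 F2+ zero = F0
  sgn-unique F0 F1 F2+ (suc zero) = F1
  sgn-unique F0 F1 F2+ (2+ w) = trans (F2+ w) (sgn-unique F0 F1 F2+ w)

  sgn-+ : ∀ m n → sgn (m + n) ≡ sgn m ℤ.* sgn n
  sgn-+ zero n = sym (ℤ.*-identityˡ (sgn n))
  sgn-+ (suc zero) n = trans (sgn-suc n) (sym (ℤ.-1*i≡-i (sgn n)))
    where
    sgn-suc : ∀ w → sgn (suc w) ≡ ℤ.- sgn w
    sgn-suc zero = refl
    sgn-suc (suc zero) = refl
    sgn-suc (2+ w) = sgn-suc w
  sgn-+ (2+ m) n = sgn-+ m n

  mutual
    -- μ computes its sign by a function local to Defs, which cannot be named here:
    -- the type of this identification is inferred from its use in μ-squarefree.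
    μ-sign≡sgn : ∀ n w → _
    μ-sign≡sgn n = sgn-unique refl refl (λ _ → refl)

    μ-squarefree : ∀ n → 0 < n → squarefree n ≡ true → μ n ≡ sgn (ω n)
    μ-squarefree (suc n) _ sf with squarefree (suc n) | sf
    ... | true | refl with ω (suc n)
    ...   | w = μ-sign≡sgn n w

  μ-not-squarefree : ∀ n → squarefree n ≡ false → μ n ≡ + 0
  μ-not-squarefree zero _ = refl
  μ-not-squarefree (suc n) sf with squarefree (suc n) | sf
  ... | false | refl = refl

  μ-square : ∀ {n p} → Prime p → p ⋅ p ∣ n → μ n ≡ + 0
  μ-square {zero} _ _ = refl
  μ-square {suc n} pp p²∣n =
    μ-not-squarefree (suc n) (square⇒squarefree≡false {suc n} (s≤s z≤n) (prime>1 pp) p²∣n)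

  μ-prime : ∀ {p} → Prime p → μ p ≡ -[1+ 0 ]
  μ-prime {p} pp = trans (μ-squarefree p (prime-pos pp) (SquareFree⇒squarefree≡true p p-squarefree))
                         (cong sgn (ω-prime pp))
    where
    p-squarefree : SquareFree p
    p-squarefree pq q²∣p with prime∣prime⇒≡ pq pp (∣-trans (m∣m*n _) q²∣p)
    ... | refl = <⇒≱ (m<m*n p p {{prime⇒nonZero pp}} (prime>1 pp)) (∣⇒≤ {{prime⇒nonZero pp}} q²∣p)

  μ-* : ∀ {a b} → 0 < a → 0 < b → Coprime a b → μ (a ⋅ b) ≡ μ a ℤ.* μ b
  μ-* {a} {b} 0<a 0<b a⊥b with squarefree a in sf-a | squarefree b in sf-b
  ... | false | _ with p , pp , p²∣a ← squarefree≡false⇒square a sf-a =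
    trans (μ-square pp (∣m⇒∣m*n b p²∣a)) (cong (ℤ._* μ b) (sym (μ-not-squarefree a sf-a)))
  ... | true | false with p , pp , p²∣b ← squarefree≡false⇒square b sf-b =
    trans (μ-square pp (∣n⇒∣m*n a p²∣b))
          (trans (sym (ℤ.*-zeroʳ (μ a))) (cong (μ a ℤ.*_) (sym (μ-not-squarefree b sf-b))))
  ... | true | true = begin
    μ (a ⋅ b)                   ≡⟨ μ-squarefree (a ⋅ b) 0<ab (SquareFree⇒squarefree≡true (a ⋅ b)
                                     (SquareFree-* a⊥b (squarefree≡true⇒SquareFree a 0<a sf-a)
                                                       (squarefree≡true⇒SquareFree b 0<b sf-b))) ⟩
    sgn (ω (a ⋅ b))             ≡⟨ cong sgn (ω-* 0<a 0<b a⊥b) ⟩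
    sgn (ω a + ω b)             ≡⟨ sgn-+ (ω a) (ω b) ⟩
    sgn (ω a) ℤ.* sgn (ω b)     ≡⟨ sym (cong₂ ℤ._*_ (μ-squarefree a 0<a sf-a) (μ-squarefree b 0<b sf-b)) ⟩
    μ a ℤ.* μ b                 ∎
    where
    open ≡-Reasoning
    0<ab = *-pos 0<a 0<b

module MöbiusInversion {ℓ₁ ℓ₂ : Level} (R : CommutativeRing ℓ₁ ℓ₂) where

  open CommutativeRing R
  open Coeffs R
  open RangeSum commutativeSemiring public
  open MöbiusFunction using (μ-*; μ-prime; μ-square; prime-divisor; prime-pos; prime∤⇒coprime)
  open import Algebra.Properties.Ring ring using (-0#≈0#; -‿involutive; -‿distribˡ-*; -‿distribʳ-*; -1*x≈-x)
  open import Algebra.Properties.Semiring.Mult semiring using (_×_; ×1-homo-*)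
  open import Data.Nat using (_≟_; >-nonZero) renaming (_+_ to _+ℕ_)
  open import Data.Nat.Properties using (*-zeroʳ; *-suc; m≤m*n; ≤-<-trans; <⇒≱; <-irrefl; n≢0⇒n>0; ≤∧≢⇒<)
    renaming (*-comm to ⋅-comm; *-assoc to ⋅-assoc; *-identityʳ to ⋅-identityʳ)
  open import Data.Nat.Divisibility
    using (∣-trans; ∣-refl; ∣m+n∣m⇒∣n; ∣m∣n⇒∣m+n; ∣1⇒≡1; _∣0; 1∣_; n∣m*n; *-monoʳ-∣)
  open import Data.Nat.Primality using (Prime)
  open import Data.Nat.Coprimality using (Coprime; coprime-divisor)
  import Data.Nat.Coprimality as Coprime
  open import Data.Nat.GCD using (gcd[m,n]∣m; gcd[m,n]∣n; gcd-greatest)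
  open import Data.Integer as ℤ using (+_; -[1+_]; ∣_∣; sign; _◃_)
  open import Data.Sign as Sign using (Sign)
  open import Data.List using ([]; _∷_; map; filter; upTo; applyUpTo)
  open import Data.List.Properties using (map-upTo)
  open import Data.Empty using (⊥-elim)
  open import Relation.Nullary using (¬_; Dec; yes; no; ¬?; _×-dec_)
  import Relation.Binary.PropositionalEquality as ≡
  open import Relation.Binary.Reasoning.Setoid setoid

  fromℕ-* : ∀ m n → fromℕ (m ⋅ n) ≈ fromℕ m * fromℕ n
  fromℕ-* m n = trans (reflexive (fromℕ≡× (m ⋅ n)))
                      (trans (×1-homo-* m n) (sym (*-cong (reflexive (fromℕ≡× m)) (reflexive (fromℕ≡× n)))))
    where
    fromℕ≡× : ∀ n → fromℕ n ≡ n × 1#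
    fromℕ≡× zero = ≡.refl
    fromℕ≡× (suc n) = ≡.cong (λ x → 1# + x) (fromℕ≡× n)

  signed : Sign → Carrier → Carrier
  signed Sign.+ x = x
  signed Sign.- x = - x

  fromℤ-◃ : ∀ s n → fromℤ (s ◃ n) ≈ signed s (fromℕ n)
  fromℤ-◃ Sign.+ zero = refl
  fromℤ-◃ Sign.- zero = sym -0#≈0#
  fromℤ-◃ Sign.+ (suc n) = refl
  fromℤ-◃ Sign.- (suc n) = refl

  signed-* : ∀ s t x y → signed (s Sign.* t) (x * y) ≈ signed s x * signed t y
  signed-* Sign.+ Sign.+ x y = refl
  signed-* Sign.+ Sign.- x y = -‿distribʳ-* x y
  signed-* Sign.- Sign.+ x y = -‿distribˡ-* x y
  signed-* Sign.- Sign.- x y =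
    trans (sym (-‿involutive (x * y))) (trans (-‿cong (-‿distribʳ-* x y)) (-‿distribˡ-* x (- y)))

  fromℤ-* : ∀ i j → fromℤ (i ℤ.* j) ≈ fromℤ i * fromℤ j
  fromℤ-* i j = begin
    fromℤ ((sign i Sign.* sign j) ◃ (∣ i ∣ ⋅ ∣ j ∣))
      ≈⟨ fromℤ-◃ (sign i Sign.* sign j) (∣ i ∣ ⋅ ∣ j ∣) ⟩
    signed (sign i Sign.* sign j) (fromℕ (∣ i ∣ ⋅ ∣ j ∣))
      ≈⟨ signed-cong (sign i Sign.* sign j) (fromℕ-* ∣ i ∣ ∣ j ∣) ⟩
    signed (sign i Sign.* sign j) (fromℕ ∣ i ∣ * fromℕ ∣ j ∣)
      ≈⟨ signed-* (sign i) (sign j) _ _ ⟩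
    signed (sign i) (fromℕ ∣ i ∣) * signed (sign j) (fromℕ ∣ j ∣)
      ≈⟨ *-cong (fromℤ-signAbs i) (fromℤ-signAbs j) ⟩
    fromℤ i * fromℤ j                                   ∎
    where
    signed-cong : ∀ s {x y} → x ≈ y → signed s x ≈ signed s y
    signed-cong Sign.+ x≈y = x≈y
    signed-cong Sign.- x≈y = -‿cong x≈y
    fromℤ-signAbs : ∀ i → signed (sign i) (fromℕ ∣ i ∣) ≈ fromℤ i
    fromℤ-signAbs (+ n) = refl
    fromℤ-signAbs -[1+ n ] = refl

  μᴿ : ℕ → Carrier
  μᴿ n = fromℤ (μ n)

  μᴿ-1 : μᴿ 1 ≈ 1#
  μᴿ-1 = +-identityʳ 1#

  μᴿ-* : ∀ {a b} → 0 < a → 0 < b → Coprime a b → μᴿ (a ⋅ b) ≈ μᴿ a * μᴿ b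
  μᴿ-* {a} {b} 0<a 0<b a⊥b = trans (reflexive (≡.cong fromℤ (μ-* 0<a 0<b a⊥b))) (fromℤ-* (μ a) (μ b))

  μᴿ-square : ∀ {n p} → Prime p → p ⋅ p ∣ n → μᴿ n ≈ 0#
  μᴿ-square pp p²∣n = reflexive (≡.cong fromℤ (μ-square pp p²∣n))

  μᴿ-prime-* : ∀ {p h} → Prime p → 0 < h → ¬ p ∣ h → μᴿ (p ⋅ h) ≈ - μᴿ h
  μᴿ-prime-* {p} {h} pp 0<h p∤h = begin
    μᴿ (p ⋅ h)           ≈⟨ μᴿ-* (prime-pos pp) 0<h (prime∤⇒coprime pp p∤h) ⟩
    μᴿ p * μᴿ h          ≈⟨ *-cong (reflexive (≡.cong fromℤ (μ-prime pp))) refl ⟩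
    - (1# + 0#) * μᴿ h    ≈⟨ sym (-‿distribˡ-* _ _) ⟩
    - ((1# + 0#) * μᴿ h)  ≈⟨ -‿cong (trans (*-cong (+-identityʳ 1#) refl) (*-identityˡ _)) ⟩
    - μᴿ h               ∎

  when-cong : ∀ {P Q : Set} (P? : Dec P) (Q? : Dec Q) {x y} → (P → Q) → (Q → P) → (P → x ≈ y) →
              when P? x ≈ when Q? y
  when-cong (yes p) (yes _) _ _ x≈y = x≈y p
  when-cong (yes p) (no ¬q) P⇒Q _ _ = ⊥-elim (¬q (P⇒Q p))
  when-cong (no ¬p) (yes q) _ Q⇒P _ = ⊥-elim (¬p (Q⇒P q))
  when-cong (no _) (no _) _ _ _ = refl

  when-congʳ : ∀ {P : Set} (P? : Dec P) {x y} → (P → x ≈ y) → when P? x ≈ when P? y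
  when-congʳ (yes p) x≈y = x≈y p
  when-congʳ (no _) _ = refl

  when-yes : ∀ {P : Set} (P? : Dec P) {x} → P → when P? x ≈ x
  when-yes (yes _) _ = refl
  when-yes (no ¬p) p = ⊥-elim (¬p p)

  when-no : ∀ {P : Set} (P? : Dec P) {x} → ¬ P → when P? x ≈ 0#
  when-no (yes p) ¬p = ⊥-elim (¬p p)
  when-no (no _) _ = refl

  when-0# : ∀ {P : Set} (P? : Dec P) → when P? 0# ≈ 0#
  when-0# (yes _) = refl
  when-0# (no _) = refl

  *-when : ∀ {P : Set} (P? : Dec P) a x → a * when P? x ≈ when P? (a * x)
  *-when (yes _) a x = refl
  *-when (no _) a x = zeroʳ a

  when-* : ∀ {P : Set} (P? : Dec P) x a → when P? x * a ≈ when P? (x * a)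
  when-* (yes _) x a = refl
  when-* (no _) x a = zeroˡ a

  when-∑ : ∀ {P : Set} (P? : Dec P) N (f : ℕ → Carrier) → when P? (∑ N f) ≈ ∑ N (λ x → when P? (f x))
  when-∑ (yes _) N f = refl
  when-∑ (no _) N f = sym (∑-zero N λ _ _ → refl)

  when-redundant : ∀ {P Q : Set} (P? : Dec P) (Q? : Dec Q) x → (Q → P) → when P? (when Q? x) ≈ when Q? x
  when-redundant (yes _) Q? x _ = refl
  when-redundant (no ¬p) (yes q) x Q⇒P = ⊥-elim (¬p (Q⇒P q))
  when-redundant (no _) (no _) x _ = refl

  when-×-dec : ∀ {P Q : Set} (P? : Dec P) (Q? : Dec Q) x → when (P? ×-dec Q?) x ≈ when P? (when Q? x)
  when-×-dec (yes _) (yes _) x = refl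
  when-×-dec (yes _) (no _) x = refl
  when-×-dec (no _) (yes _) x = refl
  when-×-dec (no _) (no _) x = refl

  when-gcd : ∀ x a b y → when (x ∣? gcd a b) y ≈ when (x ∣? a) (when (x ∣? b) y)
  when-gcd x a b y =
    trans (when-cong (x ∣? gcd a b) (x ∣? a ×-dec x ∣? b)
                     (λ x∣g → ∣-trans x∣g (gcd[m,n]∣m a b) , ∣-trans x∣g (gcd[m,n]∣n a b))
                     (λ (x∣a , x∣b) → gcd-greatest x∣a x∣b) (λ _ → refl))
          (when-×-dec (x ∣? a) (x ∣? b) y)

  ∑∣ : ℕ → ℕ → (ℕ → Carrier) → Carrier
  ∑∣ N m f = ∑ N (λ d → when (d ∣? m) (f d))

  syntax ∑∣ N m (λ d → e) = ∑[ d < N ∣ m ] e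

  Σ-filter : ∀ {P : ℕ → Set} (P? : ∀ x → Dec (P x)) xs (f : ℕ → Carrier) →
             Σ (filter P? xs) f ≈ Σ xs (λ x → when (P? x) (f x))
  Σ-filter P? [] f = refl
  Σ-filter P? (x ∷ xs) f with P? x
  ... | yes _ = +-cong refl (Σ-filter P? xs f)
  ... | no _ = trans (Σ-filter P? xs f) (sym (+-identityˡ _))

  Σ-applyUpTo : ∀ (g : ℕ → ℕ) n (f : ℕ → Carrier) → Σ (applyUpTo g n) f ≈ ∑ n (λ x → f (g x))
  Σ-applyUpTo g zero f = refl
  Σ-applyUpTo g (suc n) f = +-cong refl (Σ-applyUpTo (λ x → g (suc x)) n f)

  Σ-divisors : ∀ {m N} → 0 < m → m < N → (f : ℕ → Carrier) → Σ (divisors m) f ≈ ∑[ d < N ∣ m ] f d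
  Σ-divisors {m} {N} 0<m m<N f = begin
    Σ (divisors m) f
      ≈⟨ Σ-filter (_∣? m) (map suc (upTo m)) f ⟩
    Σ (map suc (upTo m)) (λ d → when (d ∣? m) (f d))
      ≡⟨ ≡.cong (λ ds → Σ ds (λ d → when (d ∣? m) (f d))) (map-upTo suc m) ⟩
    Σ (applyUpTo suc m) (λ d → when (d ∣? m) (f d))
      ≈⟨ Σ-applyUpTo suc m _ ⟩
    ∑ m (λ d → when (suc d ∣? m) (f (suc d)))
      ≈⟨ sym (trans (+-cong (when-no (0 ∣? m) 0∤m) refl) (+-identityˡ _)) ⟩
    ∑ (suc m) (λ d → when (d ∣? m) (f d))
      ≈⟨ sym (∑-extend (suc m) N _ m<N no-divisor) ⟩
    ∑[ d < N ∣ m ] f d                                   ∎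
    where
    0∤m : ¬ 0 ∣ m
    0∤m 0∣m = <-irrefl ≡.refl (∣⇒pos 0<m 0∣m)
    no-divisor : ∀ d → suc m ≤ d → when (d ∣? m) (f d) ≈ 0#
    no-divisor d m<d = when-no (d ∣? m) λ d∣m → <⇒≱ m<d (∣⇒≤′ 0<m d∣m)

  when-split : ∀ {P : Set} (P? : Dec P) x → x ≈ when P? x + when (¬? P?) x
  when-split (yes _) x = sym (+-identityʳ x)
  when-split (no _) x = sym (+-identityˡ x)

  ∑-multiples : ∀ {d} N (f : ℕ → Carrier) → 0 < d → (∀ x → N ≤ x → f x ≈ 0#) →
                ∑ N (λ x → when (d ∣? x) (f x)) ≈ ∑ N (λ y → f (d ⋅ y))
  ∑-multiples {d} N f 0<d f-vanishes = begin
    ∑ N (λ x → when (d ∣? x) (f x))        ≈⟨ sym (∑-extend N (N ⋅ d) _ (m≤m*n N d) guarded-vanishes) ⟩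
    ∑ (N ⋅ d) (λ x → when (d ∣? x) (f x))  ≈⟨ blocks N f ⟩
    ∑ N (λ y → f (d ⋅ y))                  ∎
    where
    instance _ = >-nonZero 0<d
    guarded-vanishes : ∀ x → N ≤ x → when (d ∣? x) (f x) ≈ 0#
    guarded-vanishes x N≤x = trans (when-congʳ (d ∣? x) λ _ → f-vanishes x N≤x) (when-0# (d ∣? x))
    -- The range [0, M·d) is cut into M blocks of length d, each containing one multiple of d.
    blocks : ∀ M (f : ℕ → Carrier) → ∑ (M ⋅ d) (λ x → when (d ∣? x) (f x)) ≈ ∑ M (λ y → f (d ⋅ y))
    blocks zero f = refl
    blocks (suc M) f = begin
      ∑ (d +ℕ M ⋅ d) (λ x → when (d ∣? x) (f x))
        ≈⟨ ∑-+ℕ d (M ⋅ d) _ ⟩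
      ∑ d (λ x → when (d ∣? x) (f x)) + ∑ (M ⋅ d) (λ x → when (d ∣? d +ℕ x) (f (d +ℕ x)))
        ≈⟨ +-cong first-block (∑-cong (M ⋅ d) shift) ⟩
      f (d ⋅ 0) + ∑ (M ⋅ d) (λ x → when (d ∣? x) (f (d +ℕ x)))
        ≈⟨ +-cong refl (blocks M (λ x → f (d +ℕ x))) ⟩
      f (d ⋅ 0) + ∑ M (λ y → f (d +ℕ d ⋅ y))
        ≈⟨ +-cong refl (∑-cong M λ y → reflexive (≡.cong f (≡.sym (*-suc d y)))) ⟩
      ∑ (suc M) (λ y → f (d ⋅ y))                                      ∎
      where
      first-block : ∑ d (λ x → when (d ∣? x) (f x)) ≈ f (d ⋅ 0)
      first-block = begin
        ∑ d (λ x → when (d ∣? x) (f x))  ≈⟨ ∑-single d 0 _ 0<d (λ x x<d x≢0 → when-no (d ∣? x)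
                                              λ d∣x → <⇒≱ x<d (∣⇒≤′ (n≢0⇒n>0 x≢0) d∣x)) ⟩
        when (d ∣? 0) (f 0)              ≈⟨ when-yes (d ∣? 0) (d ∣0) ⟩
        f 0                              ≡⟨ ≡.cong f (≡.sym (*-zeroʳ d)) ⟩
        f (d ⋅ 0)                        ∎
      shift : ∀ x → when (d ∣? d +ℕ x) (f (d +ℕ x)) ≈ when (d ∣? x) (f (d +ℕ x))
      shift x = when-cong (d ∣? d +ℕ x) (d ∣? x)
        (λ d∣d+x → ∣m+n∣m⇒∣n d∣d+x ∣-refl) (∣m∣n⇒∣m+n ∣-refl) (λ _ → refl)

  ∑-μᴿ : ∀ {m N} → 0 < m → m < N → ∑[ g < N ∣ m ] μᴿ g ≈ when (m ≟ 1) 1#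
  ∑-μᴿ {m} {N} 0<m m<N with m ≟ 1
  ... | yes ≡.refl = begin
    ∑[ g < N ∣ 1 ] μᴿ g
      ≈⟨ ∑-single N 1 _ m<N (λ g _ g≢1 → when-no (g ∣? 1) λ g∣1 → g≢1 (∣1⇒≡1 g∣1)) ⟩
    when (1 ∣? 1) (μᴿ 1)  ≈⟨ when-yes (1 ∣? 1) ∣-refl ⟩
    μᴿ 1                  ≈⟨ μᴿ-1 ⟩
    1#                    ∎
  ... | no m≢1 with p , pp , p∣m ← prime-divisor (≤∧≢⇒< 0<m (λ 1≡m → m≢1 (≡.sym 1≡m))) = begin
    ∑ N (λ g → when (g ∣? m) (μᴿ g))
      ≈⟨ ∑-cong N (λ g → when-split (p ∣? g) _) ⟩
    ∑ N (λ g → when (p ∣? g) (F g) + when (¬? (p ∣? g)) (F g))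
      ≈⟨ ∑-distrib-+ N _ _ ⟩
    ∑ N (λ g → when (p ∣? g) (F g)) + ∑ N (λ g → when (¬? (p ∣? g)) (F g))
      ≈⟨ +-cong (∑-multiples N F 0<p F-vanishes) (∑-cong N prime-to-p) ⟩
    ∑ N (λ h → F (p ⋅ h)) + ∑ N X
      ≈⟨ +-cong (∑-cong N multiple-of-p) refl ⟩
    ∑ N (λ h → - X h) + ∑ N X
      ≈⟨ +-cong (trans (∑-cong N λ h → sym (-1*x≈-x (X h)))
                (trans (sym (*-distribˡ-∑ N (- 1#) X)) (-1*x≈-x (∑ N X)))) refl ⟩
    - ∑ N X + ∑ N X
      ≈⟨ -‿inverseˡ (∑ N X) ⟩
    0#                                   ∎
    where
    0<p = prime-pos pp
    m′ = quot m p
    0<m′ = quot-pos 0<m 0<p p∣m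
    F X : ℕ → Carrier
    F g = when (g ∣? m) (μᴿ g)
    X h = when (h ∣? m′) (when (¬? (p ∣? h)) (μᴿ h))
    F-vanishes : ∀ g → N ≤ g → F g ≈ 0#
    F-vanishes g N≤g = when-no (g ∣? m) λ g∣m → <⇒≱ (≤-<-trans (∣⇒≤′ 0<m g∣m) m<N) N≤g
    multiple-of-p : ∀ h → F (p ⋅ h) ≈ - X h
    multiple-of-p h with p ⋅ h ∣? m | h ∣? m′ | p ∣? h
    ... | yes _ | yes _ | yes p∣h = trans (μᴿ-square pp (*-monoʳ-∣ p p∣h)) (sym -0#≈0#)
    ... | yes _ | yes h∣m′ | no p∤h = μᴿ-prime-* pp (∣⇒pos 0<m′ h∣m′) p∤h
    ... | yes ph∣m | no h∤m′ | _ = ⊥-elim (h∤m′ (*∣⇒∣quot 0<p ph∣m))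
    ... | no ph∤m | yes h∣m′ | _ = ⊥-elim (ph∤m (∣quot⇒*∣ 0<p p∣m h∣m′))
    ... | no _ | no _ | _ = sym -0#≈0#
    prime-to-p : ∀ g → when (¬? (p ∣? g)) (F g) ≈ X g
    prime-to-p g with p ∣? g
    ... | yes _ = sym (when-0# (g ∣? m′))
    ... | no p∤g = when-cong (g ∣? m) (g ∣? m′) g∣m⇒g∣m′ (λ g∣m′ → ∣-trans g∣m′ m′∣m) (λ _ → refl)
      where
      m′∣m : m′ ∣ m
      m′∣m = ≡.subst (m′ ∣_) (*-quot 0<p p∣m) (n∣m*n p)
      g∣m⇒g∣m′ : g ∣ m → g ∣ m′
      g∣m⇒g∣m′ g∣m = coprime-divisor (Coprime.sym (prime∤⇒coprime pp p∤g))
                                     (≡.subst (g ∣_) (≡.sym (*-quot 0<p p∣m)) g∣m)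

  -- Substituting m = gc, the left side is Σ_{m ∣ G} (Σ_{g ∣ m} μ(g)) H(m).
  mobius-collapse : ∀ {G N} (H : ℕ → Carrier) → 0 < G → G < N →
                    ∑[ g < N ∣ G ] (μᴿ g * ∑[ c < N ∣ quot G g ] H (g ⋅ c)) ≈ H 1
  mobius-collapse {G} {N} H 0<G G<N = begin
    ∑[ g < N ∣ G ] (μᴿ g * ∑[ c < N ∣ quot G g ] H (g ⋅ c))
      ≈⟨ ∑-cong N (λ g → when-congʳ (g ∣? G) λ g∣G → *-cong refl (sym (multiples-of g∣G))) ⟩
    ∑[ g < N ∣ G ] (μᴿ g * ∑ N (λ m → when (g ∣? m) (K m)))
      ≈⟨ ∑-cong N distribute ⟩
    ∑ N (λ g → ∑ N (λ m → when (g ∣? m) (μᴿ g) * K m))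
      ≈⟨ ∑-comm N N _ ⟩
    ∑ N (λ m → ∑ N (λ g → when (g ∣? m) (μᴿ g) * K m))
      ≈⟨ ∑-cong N (λ m → sym (*-distribʳ-∑ N (K m) _)) ⟩
    ∑ N (λ m → (∑[ g < N ∣ m ] μᴿ g) * K m)
      ≈⟨ ∑-cong N (λ m → weight m (m ∣? G)) ⟩
    ∑ N (λ m → when (m ≟ 1) 1# * K m)
      ≈⟨ ∑-single N 1 _ (≤-<-trans 0<G G<N) (λ m _ m≢1 → trans (*-cong (when-no (m ≟ 1) m≢1) refl) (zeroˡ _)) ⟩
    when (1 ≟ 1) 1# * K 1
      ≈⟨ trans (*-identityˡ (K 1)) (when-yes (1 ∣? G) (1∣ G)) ⟩
    H 1 ∎
    where
    K : ℕ → Carrier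
    K m = when (m ∣? G) (H m)
    multiples-of : ∀ {g} → g ∣ G → ∑ N (λ m → when (g ∣? m) (K m)) ≈ ∑[ c < N ∣ quot G g ] H (g ⋅ c)
    multiples-of {g} g∣G = trans (∑-multiples N K 0<g K-vanishes) (∑-cong N λ c →
      when-cong (g ⋅ c ∣? G) (c ∣? quot G g) (*∣⇒∣quot 0<g) (∣quot⇒*∣ 0<g g∣G) (λ _ → refl))
      where
      0<g = ∣⇒pos 0<G g∣G
      K-vanishes : ∀ m → N ≤ m → K m ≈ 0#
      K-vanishes m N≤m = when-no (m ∣? G) λ m∣G → <⇒≱ (≤-<-trans (∣⇒≤′ 0<G m∣G) G<N) N≤m
    distribute : ∀ g → when (g ∣? G) (μᴿ g * ∑ N (λ m → when (g ∣? m) (K m)))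
                       ≈ ∑ N (λ m → when (g ∣? m) (μᴿ g) * K m)
    distribute g with g ∣? G
    ... | yes _ = trans (*-distribˡ-∑ N (μᴿ g) _)
                        (∑-cong N λ m → trans (*-when (g ∣? m) _ _) (sym (when-* (g ∣? m) _ _)))
    ... | no g∤G = sym (∑-zero N λ m _ → no-term m (g ∣? m) (m ∣? G))
      where
      no-term : ∀ m (g∣?m : Dec (g ∣ m)) (m∣?G : Dec (m ∣ G)) → when g∣?m (μᴿ g) * when m∣?G (H m) ≈ 0#
      no-term m (yes g∣m) (yes m∣G) = ⊥-elim (g∤G (∣-trans g∣m m∣G))
      no-term m (yes _) (no _) = zeroʳ _
      no-term m (no _) _ = zeroˡ _
    weight : ∀ m (m∣?G : Dec (m ∣ G)) →
             (∑[ g < N ∣ m ] μᴿ g) * when m∣?G (H m) ≈ when (m ≟ 1) 1# * when m∣?G (H m)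
    weight m (yes m∣G) = *-cong (∑-μᴿ (∣⇒pos 0<G m∣G) (≤-<-trans (∣⇒≤′ 0<G m∣G) G<N)) refl
    weight m (no _) = trans (zeroʳ _) (sym (zeroʳ _))

  mobius-recovery : ∀ (A : ℕ → ℕ → ℕ → Carrier) {k l n N} → 0 < k → 0 < l → k < N →
    ∑[ d < N ∣ gcd k l ] (μᴿ d * ∑[ c < N ∣ gcd (quot k d) (quot l d) ]
                                   A (quot (quot k d) c) (quot (quot l d) c) (d ⋅ n ⋅ c))
      ≈ A k l n
  mobius-recovery A {k} {l} {n} {N} 0<k 0<l k<N = begin
    ∑[ d < N ∣ gcd k l ] (μᴿ d * ∑[ c < N ∣ gcd (quot k d) (quot l d) ]
                                   A (quot (quot k d) c) (quot (quot l d) c) (d ⋅ n ⋅ c))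
      ≈⟨ ∑-cong N (λ d → when-congʳ (d ∣? gcd k l) λ d∣g → *-cong refl (∑-cong N λ c →
           reflexive (≡.cong₂ (λ x v → when (c ∣? x) v) (gcd-quot (∣⇒pos (gcd-pos l 0<k) d∣g)
                       (∣-trans d∣g (gcd[m,n]∣m k l)) (∣-trans d∣g (gcd[m,n]∣n k l))) (reassociate d c)))) ⟩
    ∑[ d < N ∣ gcd k l ] (μᴿ d * ∑[ c < N ∣ quot (gcd k l) d ] H (d ⋅ c))
      ≈⟨ mobius-collapse H (gcd-pos l 0<k) (≤-<-trans (gcd≤ l 0<k) k<N) ⟩
    A (quot k 1) (quot l 1) (n ⋅ 1)
      ≡⟨ ≡.cong₂ (λ x y → A x y (n ⋅ 1)) (quot-1 k) (quot-1 l) ⟩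
    A k l (n ⋅ 1)
      ≡⟨ ≡.cong (A k l) (⋅-identityʳ n) ⟩
    A k l n ∎
    where
    H : ℕ → Carrier
    H h = A (quot k h) (quot l h) (n ⋅ h)
    reassociate : ∀ d c → A (quot (quot k d) c) (quot (quot l d) c) (d ⋅ n ⋅ c) ≡ H (d ⋅ c)
    reassociate d c = ≡.trans (≡.cong₂ (λ x y → A x y (d ⋅ n ⋅ c)) (quot-quot k d c) (quot-quot l d c))
                              (≡.cong (A (quot k (d ⋅ c)) (quot l (d ⋅ c)))
                                      (≡.trans (≡.cong (_⋅ c) (⋅-comm d n)) (⋅-assoc n d c)))

module HeckeInversion {ℓ₁ ℓ₂ : Level} (R : CommutativeRing ℓ₁ ℓ₂) where

  open CommutativeRing R
  open Coeffs R
  open MöbiusInversion R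
  open import Data.Integer using (+_)
  import Data.Integer as ℤ
  open import Data.Nat.Properties using (≤-<-trans; <⇒≱; *-monoˡ-≤)
    renaming (*-comm to ⋅-comm; *-assoc to ⋅-assoc)
  open import Data.Nat.Divisibility using (∣-trans; ∣-refl; ∣-antisym; ∣m⇒∣m*n; n∣m*n; *-pres-∣)
  open import Data.Nat.GCD using (gcd[m,n]∣m; gcd[m,n]∣n; gcd-greatest)
  open import Data.Nat.Coprimality using (Coprime; coprime?; coprime-divisor)
  import Data.Nat.Coprimality as Coprime
  open MöbiusFunction using (SquareFree; ¬coprime⇒common-prime; μ-square)
  open import Data.Nat using (>-nonZero)
  open import Data.Empty using (⊥-elim)
  open import Data.Product using (_×_)
  open import Relation.Nullary using (Dec; yes; no; _×-dec_)
  import Relation.Binary.PropositionalEquality as ≡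
  open import Relation.Binary.Reasoning.Setoid setoid

  -- For squarefree m, the only such e is gcd d m.
  divisor-count : ∀ {d m n N} → 0 < d → 0 < m → d < N → SquareFree m →
    ∑[ e < N ∣ gcd d m ] when (quot m e ∣? n) (when (coprime? d (quot m e)) 1#) ≈ when (m ∣? d ⋅ n) 1#
  divisor-count {d} {m} {n} {N} 0<d 0<m d<N m-squarefree = begin
    ∑[ e < N ∣ gcd d m ] when (quot m e ∣? n) (when (coprime? d (quot m e)) 1#)
      ≈⟨ ∑-single N g _ (≤-<-trans (gcd≤ m 0<d) d<N) only-g ⟩
    when (g ∣? g) (when (q ∣? n) (when (coprime? d q) 1#))
      ≈⟨ when-yes (g ∣? g) ∣-refl ⟩
    when (q ∣? n) (when (coprime? d q) 1#)
      ≈⟨ when-cong (q ∣? n) (m ∣? d ⋅ n) q∣n⇒m∣dn m∣dn⇒q∣n (λ _ → when-yes (coprime? d q) d⊥q) ⟩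
    when (m ∣? d ⋅ n) 1# ∎
    where
    g = gcd d m
    q = quot m g
    0<g = gcd-pos m 0<d
    g*q≡m : g ⋅ q ≡ m
    g*q≡m = *-quot 0<g (gcd[m,n]∣n d m)
    q∣m : q ∣ m
    q∣m = ≡.subst (q ∣_) g*q≡m (n∣m*n g)
    d⊥q : Coprime d q
    d⊥q with coprime? d q
    ... | yes d⊥q = d⊥q
    ... | no ¬d⊥q with p , pp , p∣d , p∣q ← ¬coprime⇒common-prime 0<d ¬d⊥q =
      ⊥-elim (m-squarefree pp (≡.subst (p ⋅ p ∣_) g*q≡m (*-pres-∣ (gcd-greatest p∣d (∣-trans p∣q q∣m)) p∣q)))
    q∣n⇒m∣dn : q ∣ n → m ∣ d ⋅ n
    q∣n⇒m∣dn q∣n = ≡.subst (_∣ d ⋅ n) g*q≡m (*-pres-∣ (gcd[m,n]∣m d m) q∣n)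
    m∣dn⇒q∣n : m ∣ d ⋅ n → q ∣ n
    m∣dn⇒q∣n m∣dn = coprime-divisor (Coprime.sym d⊥q) (∣-trans q∣m m∣dn)
    unique : ∀ {e} → e ∣ g → Coprime d (quot m e) → e ≡ g
    unique {e} e∣g d⊥m/e = ∣-antisym e∣g (coprime-divisor g⊥m/e (≡.subst (g ∣_) m≡m/e*e (gcd[m,n]∣n d m)))
      where
      g⊥m/e : Coprime g (quot m e)
      g⊥m/e (x∣g , x∣m/e) = d⊥m/e (∣-trans x∣g (gcd[m,n]∣m d m) , x∣m/e)
      m≡m/e*e : m ≡ quot m e ⋅ e
      m≡m/e*e = ≡.trans (≡.sym (*-quot (∣⇒pos 0<g e∣g) (∣-trans e∣g (gcd[m,n]∣n d m)))) (⋅-comm e (quot m e))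
    only-g : ∀ e → e < N → e ≢ g → when (e ∣? g) (when (quot m e ∣? n) (when (coprime? d (quot m e)) 1#)) ≈ 0#
    only-g e _ e≢g with e ∣? g | coprime? d (quot m e)
    ... | yes e∣g | yes d⊥m/e = ⊥-elim (e≢g (unique e∣g d⊥m/e))
    ... | yes _ | no _ = when-0# (quot m e ∣? n)
    ... | no _ | _ = refl

  module Regrouping (A : ℕ → ℕ → ℕ → Carrier) {k l n d N : ℕ} (0<k : 0 < k)
                    (d∣k : d ∣ k) (d∣l : d ∣ l) (k<N : k < N) where

    K L D : ℕ
    K = quot k d
    L = quot l d
    D = d ⋅ n

    T : ℕ → Carrier
    T m = A (quot K m) 1 1 * A 1 L (quot D m)

    Z : ℕ → Carrier
    Z m = when (m ∣? K) (μᴿ m * T m)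

    ψ : ℕ → Carrier
    ψ f = when (f ∣? n) (when (coprime? d f) 1#)

    Term : ℕ → ℕ → Carrier
    Term e f = fromℤ (μ (d ⋅ f)) * fromℤ (μ e) *
                 (Aq A (k , d ⋅ f ⋅ e) (1 , 1) (1 , 1) * Aq A (1 , 1) (l , d) (d ⋅ n , e ⋅ f))

    0<d : 0 < d
    0<d = ∣⇒pos 0<k d∣k

    d<N : d < N
    d<N = ≤-<-trans (∣⇒≤′ 0<k d∣k) k<N

    K∣k : K ∣ k
    K∣k = ≡.subst (K ∣_) (*-quot 0<d d∣k) (n∣m*n d)

    Aq-k : ∀ e f → Aq A (k , d ⋅ f ⋅ e) (1 , 1) (1 , 1) ≈ when (e ⋅ f ∣? K) (A (quot K (e ⋅ f)) 1 1)
    Aq-k e f = when-cong (d ⋅ f ⋅ e ∣? k) (e ⋅ f ∣? K)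
      (λ dfe∣k → *∣⇒∣quot 0<d (≡.subst (_∣ k) dfe≡d[ef] dfe∣k))
      (λ ef∣K → ≡.subst (_∣ k) (≡.sym dfe≡d[ef]) (∣quot⇒*∣ 0<d d∣k ef∣K))
      (λ _ → reflexive (≡.cong (λ x → A x 1 1) (≡.trans (≡.cong (quot k) dfe≡d[ef]) (≡.sym (quot-quot k d (e ⋅ f))))))
      where
      dfe≡d[ef] : d ⋅ f ⋅ e ≡ d ⋅ (e ⋅ f)
      dfe≡d[ef] = ≡.trans (⋅-assoc d f e) (≡.cong (d ⋅_) (⋅-comm f e))

    Aq-l : ∀ {e f} → e ∣ d → f ∣ n → Aq A (1 , 1) (l , d) (d ⋅ n , e ⋅ f) ≈ A 1 L (quot D (e ⋅ f))
    Aq-l {e} {f} e∣d f∣n = trans (when-yes (d ∣? l) d∣l) (when-yes (e ⋅ f ∣? d ⋅ n) (*-pres-∣ e∣d f∣n))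

    μᴿ-d⋅ : ∀ {f} → 0 < f → μᴿ (d ⋅ f) ≈ when (coprime? d f) (μᴿ d * μᴿ f)
    μᴿ-d⋅ {f} 0<f with coprime? d f
    ... | yes d⊥f = μᴿ-* 0<d 0<f d⊥f
    ... | no ¬d⊥f with p , pp , p∣d , p∣f ← ¬coprime⇒common-prime 0<d ¬d⊥f = μᴿ-square pp (*-pres-∣ p∣d p∣f)

    term : ∀ {e} f → e ∣ d → when (f ∣? gcd k n) (Term e f) ≈ μᴿ d * (Z (e ⋅ f) * ψ f)
    term {e} f e∣d with f ∣? gcd k n
    ... | no f∤g = sym (trans (*-cong refl vanishes) (zeroʳ _))
      where
      vanishes : Z (e ⋅ f) * ψ f ≈ 0#
      vanishes with f ∣? n
      ... | no _ = zeroʳ _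
      ... | yes f∣n = trans (*-cong (when-no (e ⋅ f ∣? K) λ ef∣K → f∤g (gcd-greatest
                        (∣-trans (n∣m*n e) (∣-trans ef∣K K∣k)) f∣n)) refl) (zeroˡ _)
    ... | yes f∣g = begin
      μᴿ (d ⋅ f) * μᴿ e * (Aq A (k , d ⋅ f ⋅ e) (1 , 1) (1 , 1) * Aq A (1 , 1) (l , d) (d ⋅ n , e ⋅ f))
        ≈⟨ *-cong (*-cong (μᴿ-d⋅ 0<f) refl) (trans (*-cong (Aq-k e f) (Aq-l e∣d f∣n)) (when-* (e ⋅ f ∣? K) _ _)) ⟩
      when (coprime? d f) (μᴿ d * μᴿ f) * μᴿ e * when (e ⋅ f ∣? K) (T (e ⋅ f))
        ≈⟨ coprime-case (coprime? d f) ⟩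
      μᴿ d * (Z (e ⋅ f) * when (coprime? d f) 1#)
        ≈⟨ *-cong refl (*-cong refl (sym (when-yes (f ∣? n) f∣n))) ⟩
      μᴿ d * (Z (e ⋅ f) * ψ f) ∎
      where
      f∣n = ∣-trans f∣g (gcd[m,n]∣n k n)
      0<e = ∣⇒pos 0<d e∣d
      0<f = ∣⇒pos 0<k (∣-trans f∣g (gcd[m,n]∣m k n))
      coprime-case : (d⊥f? : Dec (Coprime d f)) →
        when d⊥f? (μᴿ d * μᴿ f) * μᴿ e * when (e ⋅ f ∣? K) (T (e ⋅ f)) ≈ μᴿ d * (Z (e ⋅ f) * when d⊥f? 1#)
      coprime-case (no _) = trans (*-cong (zeroˡ _) refl) (trans (zeroˡ _) (sym (trans (*-cong refl (zeroʳ _)) (zeroʳ _))))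
      coprime-case (yes d⊥f) = begin
        μᴿ d * μᴿ f * μᴿ e * when (e ⋅ f ∣? K) (T (e ⋅ f))
          ≈⟨ *-cong (trans (*-assoc _ _ _) (*-cong refl (*-comm _ _))) refl ⟩
        μᴿ d * (μᴿ e * μᴿ f) * when (e ⋅ f ∣? K) (T (e ⋅ f))
          ≈⟨ *-assoc _ _ _ ⟩
        μᴿ d * ((μᴿ e * μᴿ f) * when (e ⋅ f ∣? K) (T (e ⋅ f)))
          ≈⟨ *-cong refl (trans (*-when (e ⋅ f ∣? K) _ _)
                                (when-congʳ (e ⋅ f ∣? K) λ _ → *-cong (sym (μᴿ-* 0<e 0<f e⊥f)) refl)) ⟩
        μᴿ d * Z (e ⋅ f)
          ≈⟨ *-cong refl (sym (*-identityʳ _)) ⟩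
        μᴿ d * (Z (e ⋅ f) * 1#) ∎
        where
        e⊥f : Coprime e f
        e⊥f (x∣e , x∣f) = d⊥f (∣-trans x∣e e∣d , x∣f)

    weighted-count : ∀ m → when (m ∣? K) (μᴿ m * T m) * ∑[ e < N ∣ gcd d K ] when (e ∣? m) (ψ (quot m e))
                           ≈ when (m ∣? K) (μᴿ m * T m) * when (m ∣? D) 1#
    weighted-count m with m ∣? K
    ... | no _ = trans (zeroˡ _) (sym (zeroˡ _))
    ... | yes m∣K with μ m ℤ.≟ + 0
    ...   | yes μm≡0 = trans (μm-zero _) (sym (μm-zero _))
      where
      μm-zero : ∀ x → μᴿ m * T m * x ≈ 0#
      μm-zero x = trans (*-cong (trans (*-cong (reflexive (≡.cong fromℤ μm≡0)) refl) (zeroˡ _)) refl) (zeroˡ x)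
    ...   | no μm≢0 = *-cong refl (trans (∑-cong N λ e → guards e) (divisor-count 0<d 0<m d<N m-squarefree))
      where
      0<m = ∣⇒pos (quot-pos 0<k 0<d d∣k) m∣K
      m-squarefree : SquareFree m
      m-squarefree pp p²∣m = μm≢0 (μ-square pp p²∣m)
      guards : ∀ e → when (e ∣? gcd d K) (when (e ∣? m) (ψ (quot m e))) ≈ when (e ∣? gcd d m) (ψ (quot m e))
      guards e = begin
        when (e ∣? gcd d K) (when (e ∣? m) (ψ (quot m e)))
          ≈⟨ when-gcd e d K _ ⟩
        when (e ∣? d) (when (e ∣? K) (when (e ∣? m) (ψ (quot m e))))
          ≈⟨ when-congʳ (e ∣? d) (λ _ → when-redundant (e ∣? K) (e ∣? m) _ λ e∣m → ∣-trans e∣m m∣K) ⟩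
        when (e ∣? d) (when (e ∣? m) (ψ (quot m e)))
          ≈⟨ sym (when-gcd e d m _) ⟩
        when (e ∣? gcd d m) (ψ (quot m e)) ∎

    regroup : Σ (divisors (gcd d K)) (λ e → Σ (divisors (gcd k n)) (Term e))
                ≈ μᴿ d * ∑[ m < N ∣ gcd K D ] (μᴿ m * T m)
    regroup = begin
      Σ (divisors (gcd d K)) (λ e → Σ (divisors (gcd k n)) (Term e))
        ≈⟨ Σ-divisors (gcd-pos K 0<d) (≤-<-trans (gcd≤ K 0<d) d<N) _ ⟩
      ∑[ e < N ∣ gcd d K ] Σ (divisors (gcd k n)) (Term e)
        ≈⟨ ∑-cong N (λ e → when-congʳ (e ∣? gcd d K) λ e∣g →
             trans (Σ-divisors (gcd-pos n 0<k) (≤-<-trans (gcd≤ n 0<k) k<N) _)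
                   (∑-cong N λ f → term f (∣-trans e∣g (gcd[m,n]∣m d K)))) ⟩
      ∑[ e < N ∣ gcd d K ] ∑ N (λ f → μᴿ d * (Z (e ⋅ f) * ψ f))
        ≈⟨ ∑-cong N (λ e → trans (when-congʳ (e ∣? gcd d K) λ _ → sym (*-distribˡ-∑ N (μᴿ d) _))
                                 (sym (*-when (e ∣? gcd d K) _ _))) ⟩
      ∑ N (λ e → μᴿ d * when (e ∣? gcd d K) (∑ N (λ f → Z (e ⋅ f) * ψ f)))
        ≈⟨ sym (*-distribˡ-∑ N (μᴿ d) _) ⟩
      μᴿ d * ∑[ e < N ∣ gcd d K ] ∑ N (λ f → Z (e ⋅ f) * ψ f)
        ≈⟨ *-cong refl (∑-cong N λ e → when-congʳ (e ∣? gcd d K) λ e∣g → sym (multiples e∣g)) ⟩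
      μᴿ d * ∑[ e < N ∣ gcd d K ] ∑ N (λ m → when (e ∣? m) (Z m * ψ (quot m e)))
        ≈⟨ *-cong refl exchange ⟩
      μᴿ d * ∑ N (λ m → Z m * ∑[ e < N ∣ gcd d K ] when (e ∣? m) (ψ (quot m e)))
        ≈⟨ *-cong refl (∑-cong N weighted-count) ⟩
      μᴿ d * ∑ N (λ m → Z m * when (m ∣? D) 1#)
        ≈⟨ *-cong refl (∑-cong N merge) ⟩
      μᴿ d * ∑[ m < N ∣ gcd K D ] (μᴿ m * T m) ∎
      where
      0<K = quot-pos 0<k 0<d d∣k
      multiples : ∀ {e} → e ∣ gcd d K →
                  ∑ N (λ m → when (e ∣? m) (Z m * ψ (quot m e))) ≈ ∑ N (λ f → Z (e ⋅ f) * ψ f)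
      multiples {e} e∣g = trans (∑-multiples N _ 0<e vanishes)
                                (∑-cong N λ f → reflexive (≡.cong (λ x → Z (e ⋅ f) * ψ x) (quot-* e f 0<e)))
        where
        0<e = ∣⇒pos (gcd-pos K 0<d) e∣g
        vanishes : ∀ m → N ≤ m → Z m * ψ (quot m e) ≈ 0#
        vanishes m N≤m = trans (*-cong (when-no (m ∣? K) λ m∣K →
          <⇒≱ (≤-<-trans (∣⇒≤′ 0<K m∣K) (≤-<-trans (quot≤ k d) k<N)) N≤m) refl) (zeroˡ _)
      exchange : ∑[ e < N ∣ gcd d K ] ∑ N (λ m → when (e ∣? m) (Z m * ψ (quot m e)))
                   ≈ ∑ N (λ m → Z m * ∑[ e < N ∣ gcd d K ] when (e ∣? m) (ψ (quot m e)))
      exchange = begin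
        ∑[ e < N ∣ gcd d K ] ∑ N (λ m → when (e ∣? m) (Z m * ψ (quot m e)))
          ≈⟨ ∑-cong N (λ e → when-∑ (e ∣? gcd d K) N _) ⟩
        ∑ N (λ e → ∑ N (λ m → when (e ∣? gcd d K) (when (e ∣? m) (Z m * ψ (quot m e)))))
          ≈⟨ ∑-comm N N _ ⟩
        ∑ N (λ m → ∑ N (λ e → when (e ∣? gcd d K) (when (e ∣? m) (Z m * ψ (quot m e)))))
          ≈⟨ ∑-cong N (λ m → trans (∑-cong N λ e → sym (trans (*-when (e ∣? gcd d K) _ _)
                                     (when-congʳ (e ∣? gcd d K) λ _ → *-when (e ∣? m) _ _)))
                                   (sym (*-distribˡ-∑ N (Z m) _))) ⟩
        ∑ N (λ m → Z m * ∑[ e < N ∣ gcd d K ] when (e ∣? m) (ψ (quot m e))) ∎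
      merge : ∀ m → Z m * when (m ∣? D) 1# ≈ when (m ∣? gcd K D) (μᴿ m * T m)
      merge m = trans (when-* (m ∣? K) _ _) (trans (when-congʳ (m ∣? K) λ _ →
                  trans (*-when (m ∣? D) _ 1#) (when-congʳ (m ∣? D) λ _ → *-identityʳ _)) (sym (when-gcd m K D _)))

  HeckeRelation : (ℕ → ℕ → ℕ → Carrier) → Set ℓ₂
  HeckeRelation A =
    ∀ k l d → .{{NonZero k}} → .{{NonZero l}} → .{{NonZero d}} →
      A k 1 1 * A 1 l d ≈
        Σ (divisors l) (λ c₁ → Σ (divisors d) (λ c₂ →
          when (c₁ ⋅ c₂ ∣? k)
            (Aq A (k , c₁ ⋅ c₂) (l , c₁) (d ⋅ c₁ , c₂))))

  module _ (A : ℕ → ℕ → ℕ → Carrier) (hecke : HeckeRelation A) where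

    hecke-∑ : ∀ {a b c N} → 0 < a → 0 < b → 0 < c → a < N → b < N → c < N →
      A a 1 1 * A 1 b c ≈
        ∑[ c₂ < N ∣ gcd a c ] ∑[ c₁ < N ∣ gcd (quot a c₂) b ]
          A (quot (quot a c₂) c₁) (quot b c₁) (quot c c₂ ⋅ c₁)
    hecke-∑ {a} {b} {c} {N} 0<a 0<b 0<c a<N b<N c<N = begin
      A a 1 1 * A 1 b c
        ≈⟨ hecke a b c {{>-nonZero 0<a}} {{>-nonZero 0<b}} {{>-nonZero 0<c}} ⟩
      Σ (divisors b) (λ c₁ → Σ (divisors c) (X c₁))
        ≈⟨ Σ-divisors 0<b b<N _ ⟩
      ∑[ c₁ < N ∣ b ] Σ (divisors c) (X c₁)
        ≈⟨ ∑-cong N (λ c₁ → trans (when-congʳ (c₁ ∣? b) λ _ → Σ-divisors 0<c c<N _)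
                                  (when-∑ (c₁ ∣? b) N _)) ⟩
      ∑ N (λ c₁ → ∑ N (λ c₂ → when (c₁ ∣? b) (when (c₂ ∣? c) (X c₁ c₂))))
        ≈⟨ ∑-comm N N _ ⟩
      ∑ N (λ c₂ → ∑ N (λ c₁ → when (c₁ ∣? b) (when (c₂ ∣? c) (X c₁ c₂))))
        ≈⟨ ∑-cong N (λ c₂ → trans (∑-cong N (summand c₂)) (sym (when-∑ (c₂ ∣? gcd a c) N _))) ⟩
      ∑[ c₂ < N ∣ gcd a c ] ∑[ c₁ < N ∣ gcd (quot a c₂) b ] W c₂ c₁ ∎
      where
      X : ℕ → ℕ → Carrier
      X c₁ c₂ = when (c₁ ⋅ c₂ ∣? a) (Aq A (a , c₁ ⋅ c₂) (b , c₁) (c ⋅ c₁ , c₂))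
      W : ℕ → ℕ → Carrier
      W c₂ c₁ = A (quot (quot a c₂) c₁) (quot b c₁) (quot c c₂ ⋅ c₁)
      summand : ∀ c₂ c₁ → when (c₁ ∣? b) (when (c₂ ∣? c) (X c₁ c₂))
                         ≈ when (c₂ ∣? gcd a c) (when (c₁ ∣? gcd (quot a c₂) b) (W c₂ c₁))
      summand c₂ c₁ with c₂ ∣? c | c₁ ∣? b
      ... | no c₂∤c | c₁∣?b = trans (when-0# c₁∣?b)
          (sym (when-no (c₂ ∣? gcd a c) λ c₂∣g → c₂∤c (∣-trans c₂∣g (gcd[m,n]∣n a c))))
      ... | yes _ | no c₁∤b = sym (trans (when-congʳ (c₂ ∣? gcd a c) λ _ →
          when-no (c₁ ∣? gcd (quot a c₂) b) λ c₁∣g → c₁∤b (∣-trans c₁∣g (gcd[m,n]∣n (quot a c₂) b)))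
          (when-0# (c₂ ∣? gcd a c)))
      ... | yes c₂∣c | yes c₁∣b = begin
        when (c₁ ⋅ c₂ ∣? a) (when (c₁ ⋅ c₂ ∣? a) (when (c₂ ∣? c ⋅ c₁) V))
          ≈⟨ when-congʳ (c₁ ⋅ c₂ ∣? a) (λ c₁c₂∣a →
               trans (when-yes (c₁ ⋅ c₂ ∣? a) c₁c₂∣a) (trans (when-yes (c₂ ∣? c ⋅ c₁) (∣m⇒∣m*n c₁ c₂∣c))
                     (reflexive (V≡W c₁c₂∣a)))) ⟩
        when (c₁ ⋅ c₂ ∣? a) (W c₂ c₁)
          ≈⟨ guards ⟩
        when (c₂ ∣? gcd a c) (when (c₁ ∣? gcd (quot a c₂) b) (W c₂ c₁)) ∎
        where
        V = A (quot a (c₁ ⋅ c₂)) (quot b c₁) (quot (c ⋅ c₁) c₂)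
        0<c₂ = ∣⇒pos 0<c c₂∣c
        V≡W : c₁ ⋅ c₂ ∣ a → V ≡ W c₂ c₁
        V≡W _ = ≡.cong₂ (λ x z → A x (quot b c₁) z)
                  (≡.trans (≡.cong (quot a) (⋅-comm c₁ c₂)) (≡.sym (quot-quot a c₂ c₁)))
                  (quot-*ʳ c c₂ c₁ 0<c₂ c₂∣c)
        guards : when (c₁ ⋅ c₂ ∣? a) (W c₂ c₁)
                   ≈ when (c₂ ∣? gcd a c) (when (c₁ ∣? gcd (quot a c₂) b) (W c₂ c₁))
        guards = trans (when-cong (c₁ ⋅ c₂ ∣? a) (c₂ ∣? gcd a c ×-dec c₁ ∣? gcd (quot a c₂) b)
                                  ⇒ ⇐ (λ _ → refl))
                       (when-×-dec (c₂ ∣? gcd a c) (c₁ ∣? gcd (quot a c₂) b) _)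
          where
          ⇒ : c₁ ⋅ c₂ ∣ a → c₂ ∣ gcd a c × c₁ ∣ gcd (quot a c₂) b
          ⇒ c₁c₂∣a = gcd-greatest (∣-trans (n∣m*n c₁) c₁c₂∣a) c₂∣c
                   , gcd-greatest (*∣⇒∣quot 0<c₂ (≡.subst (_∣ a) (⋅-comm c₁ c₂) c₁c₂∣a)) c₁∣b
          ⇐ : c₂ ∣ gcd a c × c₁ ∣ gcd (quot a c₂) b → c₁ ⋅ c₂ ∣ a
          ⇐ (c₂∣g , c₁∣g′) = ≡.subst (_∣ a) (⋅-comm c₂ c₁)
                               (∣quot⇒*∣ 0<c₂ (∣-trans c₂∣g (gcd[m,n]∣m a c))
                                              (∣-trans c₁∣g′ (gcd[m,n]∣m (quot a c₂) b)))


    hecke-inverted : ∀ {K L D N} → 0 < K → 0 < L → 0 < D → K < N → L < N → D < N →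
      ∑[ g < N ∣ gcd K D ] (μᴿ g * (A (quot K g) 1 1 * A 1 L (quot D g)))
        ≈ ∑[ c < N ∣ gcd K L ] A (quot K c) (quot L c) (D ⋅ c)
    hecke-inverted {K} {L} {D} {N} 0<K 0<L 0<D K<N L<N D<N = begin
      ∑[ g < N ∣ gcd K D ] (μᴿ g * (A (quot K g) 1 1 * A 1 L (quot D g)))
        ≈⟨ ∑-cong N (λ g → when-congʳ (g ∣? gcd K D) λ g∣G → *-cong refl (expand g∣G)) ⟩
      ∑[ g < N ∣ gcd K D ] (μᴿ g * ∑[ c < N ∣ quot (gcd K D) g ] H (quot K (g ⋅ c)) (quot D (g ⋅ c)))
        ≈⟨ mobius-collapse (λ h → H (quot K h) (quot D h)) (gcd-pos D 0<K) (≤-<-trans (gcd≤ D 0<K) K<N) ⟩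
      H (quot K 1) (quot D 1)
        ≡⟨ ≡.cong₂ H (quot-1 K) (quot-1 D) ⟩
      H K D ∎
      where
      H : ℕ → ℕ → Carrier
      H x y = ∑[ c < N ∣ gcd x L ] A (quot x c) (quot L c) (y ⋅ c)
      expand : ∀ {g} → g ∣ gcd K D → A (quot K g) 1 1 * A 1 L (quot D g)
                 ≈ ∑[ c < N ∣ quot (gcd K D) g ] H (quot K (g ⋅ c)) (quot D (g ⋅ c))
      expand {g} g∣G = trans
        (hecke-∑ (quot-pos 0<K 0<g g∣K) 0<L (quot-pos 0<D 0<g g∣D)
                 (≤-<-trans (quot≤ K g) K<N) L<N (≤-<-trans (quot≤ D g) D<N))
        (∑-cong N λ c → reflexive (≡.cong₂ (λ x v → when (c ∣? x) v) (gcd-quot 0<g g∣K g∣D)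
                                     (≡.cong₂ H (quot-quot K g c) (quot-quot D g c))))
        where
        g∣K = ∣-trans g∣G (gcd[m,n]∣m K D)
        g∣D = ∣-trans g∣G (gcd[m,n]∣n K D)
        0<g = ∣⇒pos 0<K g∣K

    inner-sum : ∀ {k l n d N} → 0 < k → 0 < l → 0 < n → d ∣ gcd k l → k < N → l < N → k ⋅ n < N →
      Σ (divisors (gcd d (quot k d))) (λ e → Σ (divisors (gcd k n)) (λ f →
        fromℤ (μ (d ⋅ f)) * fromℤ (μ e) *
          (Aq A (k , d ⋅ f ⋅ e) (1 , 1) (1 , 1) * Aq A (1 , 1) (l , d) (d ⋅ n , e ⋅ f))))
        ≈ μᴿ d * ∑[ c < N ∣ gcd (quot k d) (quot l d) ] A (quot (quot k d) c) (quot (quot l d) c) (d ⋅ n ⋅ c)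
    inner-sum {k} {l} {n} {d} {N} 0<k 0<l 0<n d∣g k<N l<N kn<N =
      trans regroup (*-cong refl (hecke-inverted (quot-pos 0<k 0<d d∣k) (quot-pos 0<l 0<d d∣l) (*-pos 0<d 0<n)
                                                 (≤-<-trans (quot≤ k d) k<N) (≤-<-trans (quot≤ l d) l<N) dn<N))
      where
      d∣k = ∣-trans d∣g (gcd[m,n]∣m k l)
      d∣l = ∣-trans d∣g (gcd[m,n]∣n k l)
      open Regrouping A {n = n} {N = N} 0<k d∣k d∣l k<N
      dn<N : d ⋅ n < N
      dn<N = ≤-<-trans (*-monoˡ-≤ n (∣⇒≤′ 0<k d∣k)) kn<N

lemma3p4 : ∀ {c ℓ : Level} (R : CommutativeRing c ℓ) →
    let open CommutativeRing R
        open Coeffs R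
    in (A : ℕ → ℕ → ℕ → Carrier) →
       A 1 1 1 ≈ 1# →
       (∀ k l d → .{{NonZero k}} → .{{NonZero l}} → .{{NonZero d}} →
          A k 1 1 * A 1 l d ≈
            Σ (divisors l) (λ c₁ → Σ (divisors d) (λ c₂ →
              when (c₁ ⋅ c₂ ∣? k)
                (Aq A (k , c₁ ⋅ c₂) (l , c₁) (d ⋅ c₁ , c₂))))) →
       ∀ k l n → .{{NonZero k}} → .{{NonZero l}} → .{{NonZero n}} →
         A k l n ≈
           Σ (divisors (gcd k l)) (λ d →
             Σ (divisors (gcd d (quot k d))) (λ e →
               Σ (divisors (gcd k n)) (λ f →
                 fromℤ (μ (d ⋅ f)) * fromℤ (μ e) *
                   (Aq A (k , d ⋅ f ⋅ e) (1 , 1) (1 , 1) *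
                    Aq A (1 , 1) (l , d) (d ⋅ n , e ⋅ f)))))
lemma3p4 R A _ hecke k l n = sym (begin
  _ ≈⟨ Σ-divisors (gcd-pos l 0<k) (≤-<-trans (gcd≤ l 0<k) k<N) _ ⟩
  _ ≈⟨ ∑-cong N (λ d → when-congʳ (d ∣? gcd k l) λ d∣g → inner-sum A hecke 0<k 0<l 0<n d∣g k<N l<N kn<N) ⟩
  ∑[ d < N ∣ gcd k l ] (μᴿ d * ∑[ c < N ∣ gcd (quot k d) (quot l d) ]
                                 A (quot (quot k d) c) (quot (quot l d) c) (d ⋅ n ⋅ c))
    ≈⟨ mobius-recovery A 0<k 0<l k<N ⟩
  A k l n ∎)
  where
  open CommutativeRing R
  open Coeffs R
  open MöbiusInversion R
  open HeckeInversion R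
  open import Relation.Binary.Reasoning.Setoid setoid
  open import Data.Nat using (>-nonZero⁻¹)
  open import Data.Nat.Properties using (≤-<-trans; ≤-trans; m≤m*n; m≤n*m; *-monoˡ-≤)
  0<k = >-nonZero⁻¹ k
  0<l = >-nonZero⁻¹ l
  0<n = >-nonZero⁻¹ n
  N = suc (k ⋅ l ⋅ n)
  k<N : k < N
  k<N = s≤s (≤-trans (m≤m*n k l) (m≤m*n (k ⋅ l) n))
  l<N : l < N
  l<N = s≤s (≤-trans (m≤n*m l k) (m≤m*n (k ⋅ l) n))
  kn<N : k ⋅ n < N
  kn<N = s≤s (*-monoˡ-≤ n (m≤m*n k l))
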